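{- For $n\ge1$ let $v_n(p,q):=\sum_{w\in\mathcal F_{n,2}}p^{\mathrm{edg}(G(w))}q^{\mathrm{ver}(G(w))}$. Then for all $n\ge3$, $$v_n(p,q)=p^3q^2v_{n-1}(p,q)+p^9q^6v_{n-2}(p,q),$$ with $v_1(p,q)=p^4q^4+p^7q^6$ and $v_2(p,q)=p^7q^6+2p^{10}q^8$. Moreover, for all $n\ge1$, $$v_n(p,q)=\sum_{i=0}^{\lfloor (n+1)/2\rfloor}\binom{n+1-i}{i}p^{3n+1+3i}q^{2n+2+2i}.$$
   Context: $\mathcal F_{n,2}$ is the set of binary words $w=w_1\cdots w_n$ with no two consecutive $1$'s. $P(w)$ is the bargraph polyomino formed by the unit squares $[i-1,i]\times[j-1,j]$, $1\le i\le n$, $1\le j\le w_i+1$. $G(w)$ is the graph whose vertices are the corners of the cells of $P(w)$ and whose edges are the cell sides. $\mathrm{ver}(G)$ and $\mathrm{edg}(G)$ denote the numbers of vertices and edges of $G$. -}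

module Defs where

open import Data.Bool using (Bool; true; false; _∧_; _∨_; not; if_then_else_)
open import Data.Nat using (ℕ; zero; suc; _+_; _*_; _^_; _∸_; _≡ᵇ_)
open import Data.Product using (_×_; _,_)
open import Data.List using (List; []; _∷_; _++_; map; concatMap; filterᵇ; length; upTo)
open import Data.Bool.ListAction using (any)
open import Data.Nat.ListAction using (sum)
open import Data.Vec using (Vec; []; _∷_; toList)

-- A binary word of length n: w_i = 1 is encoded as true, w_i = 0 as false.

allWords : (n : ℕ) → List (Vec Bool n)
allWords zero = [] ∷ []
allWords (suc n) = concatMap (λ w → (false ∷ w) ∷ (true ∷ w) ∷ []) (allWords n)

noConsecOnes : {n : ℕ} → Vec Bool n → Bool
noConsecOnes [] = true
noConsecOnes (_ ∷ []) = true
noConsecOnes (a ∷ b ∷ w) = not (a ∧ b) ∧ noConsecOnes (b ∷ w)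

F₂ : (n : ℕ) → List (Vec Bool n)
F₂ n = filterᵇ noConsecOnes (allWords n)

val : Bool → ℕ
val true = 1
val false = 0

-- Cells of P(w): the cell [i-1,i]×[j-1,j] is recorded as (i , j),
-- for 1 ≤ i ≤ n and 1 ≤ j ≤ w_i + 1.
cellsFrom : ℕ → List Bool → List (ℕ × ℕ)
cellsFrom k [] = []
cellsFrom k (b ∷ bs) = map (λ j → (suc k , suc j)) (upTo (suc (val b))) ++ cellsFrom (suc k) bs

cells : {n : ℕ} → Vec Bool n → List (ℕ × ℕ)
cells w = cellsFrom 0 (toList w)

isCorner : ℕ × ℕ → ℕ × ℕ → Bool
isCorner (x , y) (i , j) = ((suc x ≡ᵇ i) ∨ (x ≡ᵇ i)) ∧ ((suc y ≡ᵇ j) ∨ (y ≡ᵇ j))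

-- horizontal unit segment [x,x+1]×{y} is a side of cell (i , j)
isHSide : ℕ × ℕ → ℕ × ℕ → Bool
isHSide (x , y) (i , j) = (suc x ≡ᵇ i) ∧ ((suc y ≡ᵇ j) ∨ (y ≡ᵇ j))

-- vertical unit segment {x}×[y,y+1] is a side of cell (i , j)
isVSide : ℕ × ℕ → ℕ × ℕ → Bool
isVSide (x , y) (i , j) = ((suc x ≡ᵇ i) ∨ (x ≡ᵇ i)) ∧ (suc y ≡ᵇ j)

-- Lattice points (x , y) with 0 ≤ x ≤ n, 0 ≤ y ≤ 2; every corner / segment
-- endpoint of P(w) lies in this box since every column has height ≤ 2.
box : ℕ → List (ℕ × ℕ)
box n = concatMap (λ x → map (λ y → (x , y)) (upTo 3)) (upTo (suc n))

ver : {n : ℕ} → Vec Bool n → ℕ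
ver {n} w = length (filterᵇ (λ pt → any (isCorner pt) (cells w)) (box n))

edg : {n : ℕ} → Vec Bool n → ℕ
edg {n} w = length (filterᵇ (λ s → any (isHSide s) (cells w)) (box n))
          + length (filterᵇ (λ s → any (isVSide s) (cells w)) (box n))

v : ℕ → ℕ → ℕ → ℕ
v n p q = sum (map (λ w → p ^ edg w * q ^ ver w) (F₂ n))

{-# OPTIONS --safe #-}
-- A word of 𝓕_{n,2} with k ones gives a bargraph with 3n + 1 + 3k edges and
-- 2n + 2 + 2k vertices.  To see this, count corners and sides along the vertical
-- lines x = 0, …, n: the incidence relations "corner of", "horizontal side of" and
-- "vertical side of" are translation invariant and only see the two columns next
-- to the line, and the count on each line is affine in the two letters there as
-- long as they are not both 1.  Hence v_n is the sum over 𝓕_{n,2} of a monomial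
-- depending only on the number of ones.  Splitting off a leading 0 or 10 gives a
-- Fibonacci-type recurrence for such sums, whence the recurrence for v_n, and
-- Pascal's rule solves it: 𝓕_{n,2} has C(n+1-k, k) words with k ones.
module Submission where

open import Defs
open import Data.Nat using (ℕ; _+_; _*_; _^_; _∸_; _≤_; ⌊_/2⌋)
open import Data.Nat.Combinatorics using (_C_)
open import Data.List using (map; upTo)
open import Data.Nat.ListAction using (sum)
open import Data.Product using (_×_)
open import Relation.Binary.PropositionalEquality using (_≡_)

open import Function using (_∘_)
open import Data.Bool using (Bool; true; false; _∧_; _∨_; not; if_then_else_)
open import Data.Bool.Properties using (∨-assoc; ∨-identityʳ)
open import Data.Bool.ListAction using (any)
open import Data.Nat using (zero; suc; _<_; z≤n; s≤s; z<s)
open import Data.Nat.Properties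
open import Data.Nat.Combinatorics using (nCk+nC[k+1]≡[n+1]C[k+1]; k>n⇒nCk≡0)
open import Data.Nat.ListAction.Properties using (sum-++)
open import Data.Nat.Tactic.RingSolver using (solve-∀)
open import Data.Product using (_,_)
open import Data.List using (List; []; _∷_; _++_; concatMap; filterᵇ; length; applyUpTo)
open import Data.List.Properties
  using (map-++; map-∘; map-cong; map-upTo; concatMap-map; map-concatMap; ++-assoc; ++-identityʳ)
open import Data.Vec using (Vec; []; _∷_; toList)
open import Relation.Binary.PropositionalEquality
  using (refl; sym; trans; cong; cong₂; subst; module ≡-Reasoning)
open import Relation.Nullary using (yes; no)
open import Algebra.Properties.CommutativeSemigroup +-commutativeSemigroup
  using () renaming (interchange to +-interchange)
open import Algebra.Properties.CommutativeSemigroup *-commutativeSemigroup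
  using () renaming (interchange to *-interchange)

open ≡-Reasoning

module _ {A : Set} where

  length-filterᵇ : (p : A → Bool) (xs : List A) → length (filterᵇ p xs) ≡ sum (map (val ∘ p) xs)
  length-filterᵇ p [] = refl
  length-filterᵇ p (x ∷ xs) with p x
  ... | true  = cong suc (length-filterᵇ p xs)
  ... | false = length-filterᵇ p xs

  sum-filterᵇ : (p : A → Bool) (f : A → ℕ) (xs : List A) →
                sum (map f (filterᵇ p xs)) ≡ sum (map (λ x → if p x then f x else 0) xs)
  sum-filterᵇ p f [] = refl
  sum-filterᵇ p f (x ∷ xs) with p x
  ... | true  = cong (f x +_) (sum-filterᵇ p f xs)
  ... | false = sum-filterᵇ p f xs

  sum-map-+ : (f g : A → ℕ) (xs : List A) →
              sum (map (λ x → f x + g x) xs) ≡ sum (map f xs) + sum (map g xs)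
  sum-map-+ f g [] = refl
  sum-map-+ f g (x ∷ xs) =
    trans (cong (f x + g x +_) (sum-map-+ f g xs)) (+-interchange (f x) (g x) _ _)

  sum-map-*ˡ : (c : ℕ) (f : A → ℕ) (xs : List A) → sum (map (λ x → c * f x) xs) ≡ c * sum (map f xs)
  sum-map-*ˡ c f [] = sym (*-zeroʳ c)
  sum-map-*ˡ c f (x ∷ xs) =
    trans (cong (c * f x +_) (sum-map-*ˡ c f xs)) (sym (*-distribˡ-+ c (f x) _))

sum-applyUpTo-+ : ∀ {f g h : ℕ → ℕ} → (∀ i → f i + g i ≡ h i) →
                  ∀ m → sum (applyUpTo f m) + sum (applyUpTo g m) ≡ sum (applyUpTo h m)
sum-applyUpTo-+ e zero = refl
sum-applyUpTo-+ {f} {g} e (suc m) =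
  trans (+-interchange (f 0) _ (g 0) _) (cong₂ _+_ (e 0) (sum-applyUpTo-+ (e ∘ suc) m))

sum-applyUpTo-truncate : ∀ (f : ℕ → ℕ) {k m} → k ≤ m → (∀ i → k ≤ i → f i ≡ 0) →
                         sum (applyUpTo f m) ≡ sum (applyUpTo f k)
sum-applyUpTo-truncate f {zero} {zero} _ _ = refl
sum-applyUpTo-truncate f {zero} {suc m} _ f≡0 =
  cong₂ _+_ (f≡0 0 z≤n) (sum-applyUpTo-truncate (f ∘ suc) {zero} {m} z≤n (λ i _ → f≡0 (suc i) z≤n))
sum-applyUpTo-truncate f {suc k} {suc m} (s≤s k≤m) f≡0 =
  cong (f 0 +_) (sum-applyUpTo-truncate (f ∘ suc) k≤m (λ i k≤i → f≡0 (suc i) (s≤s k≤i)))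

ones : ∀ {n} → Vec Bool n → ℕ
ones [] = 0
ones (b ∷ w) = val b + ones w

shift : ℕ × ℕ → ℕ × ℕ
shift (x , y) = suc x , y

column : ℕ → Bool → List (ℕ × ℕ)
column i b = map (λ j → i , suc j) (upTo (suc (val b)))

-- The cells of the word  a ∷ bs  translated one unit to the left.
shiftedCells : Bool → List Bool → List (ℕ × ℕ)
shiftedCells a bs = column 0 a ++ cellsFrom 0 bs

column-shift : ∀ i b → column (suc i) b ≡ map shift (column i b)
column-shift i false = refl
column-shift i true  = refl

cellsFrom-shift : ∀ k bs → cellsFrom (suc k) bs ≡ map shift (cellsFrom k bs)
cellsFrom-shift k [] = refl
cellsFrom-shift k (b ∷ bs) =
  trans (cong₂ _++_ (column-shift (suc k) b) (cellsFrom-shift (suc k) bs))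
        (sym (map-++ shift (column (suc k) b) (cellsFrom (suc k) bs)))

cellsFrom-∷ : ∀ b bs → cellsFrom 0 (b ∷ bs) ≡ map shift (shiftedCells b bs)
cellsFrom-∷ b bs =
  trans (cong₂ _++_ (column-shift 0 b) (cellsFrom-shift 0 bs))
        (sym (map-++ shift (column 0 b) (cellsFrom 0 bs)))

boxColumn : ℕ → List (ℕ × ℕ)
boxColumn x = map (λ y → x , y) (upTo 3)

box-suc : ∀ n → box (suc n) ≡ box 0 ++ map shift (box n)
box-suc n = cong (box 0 ++_) (begin
  concatMap boxColumn (applyUpTo suc (suc n))        ≡⟨ cong (concatMap boxColumn) (map-upTo suc (suc n)) ⟨
  concatMap boxColumn (map suc (upTo (suc n)))        ≡⟨ concatMap-map boxColumn suc (upTo (suc n)) ⟩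
  concatMap (map shift ∘ boxColumn) (upTo (suc n))    ≡⟨ map-concatMap shift boxColumn (upTo (suc n)) ⟨
  map shift (box n)                                   ∎)

module ColumnwiseCount
  (R : ℕ × ℕ → ℕ × ℕ → Bool)
  (R-shift : ∀ x y i j → R (suc x , y) (suc i , j) ≡ R (x , y) (i , j))
  (R-left : ∀ x y j → R (suc x , y) (0 , j) ≡ false)
  (R-far : ∀ y i j → R (0 , y) (suc (suc i) , j) ≡ false)
  where

  adjacent : List (ℕ × ℕ) → ℕ × ℕ → Bool
  adjacent cs pt = any (R pt) cs

  count : List (ℕ × ℕ) → ℕ → ℕ
  count cs n = sum (map (val ∘ adjacent cs) (box n))

  adjacent-++ : ∀ cs ds pt → adjacent (cs ++ ds) pt ≡ adjacent cs pt ∨ adjacent ds pt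
  adjacent-++ [] ds pt = refl
  adjacent-++ (c ∷ cs) ds pt =
    trans (cong (R pt c ∨_) (adjacent-++ cs ds pt)) (sym (∨-assoc (R pt c) _ _))

  adjacent-shift : ∀ cs x y → adjacent (map shift cs) (suc x , y) ≡ adjacent cs (x , y)
  adjacent-shift [] x y = refl
  adjacent-shift ((i , j) ∷ cs) x y = cong₂ _∨_ (R-shift x y i j) (adjacent-shift cs x y)

  adjacent-column₀ : ∀ a x y → adjacent (column 0 a) (suc x , y) ≡ false
  adjacent-column₀ false x y rewrite R-left x y 1 = refl
  adjacent-column₀ true  x y rewrite R-left x y 1 | R-left x y 2 = refl

  adjacent-far : ∀ k bs y → adjacent (cellsFrom (suc k) bs) (0 , y) ≡ false
  adjacent-far k [] y = refl
  adjacent-far k (false ∷ bs) y rewrite R-far y k 1 = adjacent-far (suc k) bs y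
  adjacent-far k (true ∷ bs)  y rewrite R-far y k 1 | R-far y k 2 = adjacent-far (suc k) bs y

  adjacent-cellsFrom-∷ : ∀ b bs x y →
    adjacent (cellsFrom 0 (b ∷ bs)) (suc x , y) ≡ adjacent (shiftedCells b bs) (x , y)
  adjacent-cellsFrom-∷ b bs x y =
    trans (cong (λ cs → adjacent cs (suc x , y)) (cellsFrom-∷ b bs))
          (adjacent-shift (shiftedCells b bs) x y)

  adjacent-shiftedCells-∷ : ∀ a b bs x y →
    adjacent (shiftedCells a (b ∷ bs)) (suc x , y) ≡ adjacent (shiftedCells b bs) (x , y)
  adjacent-shiftedCells-∷ a b bs x y =
    trans (adjacent-++ (column 0 a) (cellsFrom 0 (b ∷ bs)) (suc x , y))
          (trans (cong (_∨ _) (adjacent-column₀ a x y)) (adjacent-cellsFrom-∷ b bs x y))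

  count-suc : ∀ cs ds n → (∀ x y → adjacent cs (suc x , y) ≡ adjacent ds (x , y)) →
              count cs (suc n) ≡ count cs 0 + count ds n
  count-suc cs ds n e = begin
    sum (map g (box (suc n)))                         ≡⟨ cong (sum ∘ map g) (box-suc n) ⟩
    sum (map g (box 0 ++ map shift (box n)))          ≡⟨ cong sum (map-++ g (box 0) (map shift (box n))) ⟩
    sum (map g (box 0) ++ map g (map shift (box n)))  ≡⟨ sum-++ (map g (box 0)) (map g (map shift (box n))) ⟩
    count cs 0 + sum (map g (map shift (box n)))      ≡⟨ cong (λ l → count cs 0 + sum l) (map-∘ {g = g} {f = shift} (box n)) ⟨
    count cs 0 + sum (map (g ∘ shift) (box n))        ≡⟨ cong (λ l → count cs 0 + sum l) (map-cong (λ { (x , y) → cong val (e x y) }) (box n)) ⟩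
    count cs 0 + count ds n                           ∎
    where
    g : ℕ × ℕ → ℕ
    g = val ∘ adjacent cs

  count₀-cong : ∀ cs ds → (∀ y → adjacent cs (0 , y) ≡ adjacent ds (0 , y)) → count cs 0 ≡ count ds 0
  count₀-cong cs ds e =
    cong₂ _+_ (cong val (e 0)) (cong₂ _+_ (cong val (e 1)) (cong₂ _+_ (cong val (e 2)) refl))

  count₀-far : ∀ cs bs → count (cs ++ cellsFrom 1 bs) 0 ≡ count cs 0
  count₀-far cs bs = count₀-cong (cs ++ cellsFrom 1 bs) cs λ y →
    trans (adjacent-++ cs (cellsFrom 1 bs) (0 , y))
          (trans (cong (adjacent cs (0 , y) ∨_) (adjacent-far 0 bs y)) (∨-identityʳ _))

  count-cellsFrom-∷ : ∀ b bs n →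
    count (cellsFrom 0 (b ∷ bs)) (suc n) ≡ count (column 1 b) 0 + count (shiftedCells b bs) n
  count-cellsFrom-∷ b bs n =
    trans (count-suc (cellsFrom 0 (b ∷ bs)) (shiftedCells b bs) n (adjacent-cellsFrom-∷ b bs))
          (cong (_+ count (shiftedCells b bs) n) (count₀-far (column 1 b) bs))

  count-shiftedCells-∷ : ∀ a b bs n →
    count (shiftedCells a (b ∷ bs)) (suc n) ≡ count (column 0 a ++ column 1 b) 0 + count (shiftedCells b bs) n
  count-shiftedCells-∷ a b bs n =
    trans (count-suc (shiftedCells a (b ∷ bs)) (shiftedCells b bs) n (adjacent-shiftedCells-∷ a b bs))
          (cong (_+ count (shiftedCells b bs) n)
                (trans (cong (λ cs → count cs 0) (sym (++-assoc (column 0 a) (column 1 b) (cellsFrom 1 bs))))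
                       (count₀-far (column 0 a ++ column 1 b) bs)))

  -- For corners the middle count is
  -- really 2 + [a ∨ b], which is affine only when a ∧ b is false.
  module ClosedForm (c e s t : ℕ)
    (count-column₀ : ∀ a → count (column 0 a) 0 ≡ e + s * val a)
    (count-column₁ : ∀ b → count (column 1 b) 0 ≡ c + t * val b)
    (count-columns : ∀ a b → not (a ∧ b) ≡ true → count (column 0 a ++ column 1 b) 0 ≡ c + s * val a + t * val b)
    where

    count-shiftedCells-step : ∀ {n} a b (w : Vec Bool n) → not (a ∧ b) ≡ true →
      count (shiftedCells b (toList w)) n ≡ c * n + e + s * val b + (s + t) * ones w →
      count (shiftedCells a (b ∷ toList w)) (suc n) ≡ c * suc n + e + s * val a + (s + t) * ones (b ∷ w)
    count-shiftedCells-step {n} a b w ab ih = begin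
      count (shiftedCells a (b ∷ toList w)) (suc n)
        ≡⟨ count-shiftedCells-∷ a b (toList w) n ⟩
      count (column 0 a ++ column 1 b) 0 + count (shiftedCells b (toList w)) n
        ≡⟨ cong₂ _+_ (count-columns a b ab) ih ⟩
      c + s * val a + t * val b + (c * n + e + s * val b + (s + t) * ones w)
        ≡⟨ regroup c e s t (val a) (val b) n (ones w) ⟩
      c * suc n + e + s * val a + (s + t) * (val b + ones w)
        ∎
      where
      regroup : ∀ c e s t A B n O →
        c + s * A + t * B + (c * n + e + s * B + (s + t) * O) ≡ c * suc n + e + s * A + (s + t) * (B + O)
      regroup = solve-∀

    count-shiftedCells : ∀ {n} a (w : Vec Bool n) → noConsecOnes (a ∷ w) ≡ true →
      count (shiftedCells a (toList w)) n ≡ c * n + e + s * val a + (s + t) * ones w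
    count-shiftedCells a [] _ = begin
      count (column 0 a ++ []) 0         ≡⟨ cong (λ cs → count cs 0) (++-identityʳ (column 0 a)) ⟩
      count (column 0 a) 0               ≡⟨ count-column₀ a ⟩
      e + s * val a                      ≡⟨ pad c e s t (val a) ⟩
      c * 0 + e + s * val a + (s + t) * 0 ∎
      where
      pad : ∀ c e s t A → e + s * A ≡ c * 0 + e + s * A + (s + t) * 0
      pad = solve-∀
    count-shiftedCells false (b ∷ w) nc = count-shiftedCells-step false b w refl (count-shiftedCells b w nc)
    count-shiftedCells true (false ∷ w) nc = count-shiftedCells-step true false w refl (count-shiftedCells false w nc)
    count-shiftedCells true (true ∷ w) ()

    count-cells : ∀ {n} (w : Vec Bool (suc n)) → noConsecOnes w ≡ true →
      count (cells w) (suc n) ≡ c * suc n + e + (s + t) * ones w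
    count-cells {n} (b ∷ w) nc = begin
      count (cellsFrom 0 (b ∷ toList w)) (suc n)
        ≡⟨ count-cellsFrom-∷ b (toList w) n ⟩
      count (column 1 b) 0 + count (shiftedCells b (toList w)) n
        ≡⟨ cong₂ _+_ (count-column₁ b) (count-shiftedCells b w nc) ⟩
      c + t * val b + (c * n + e + s * val b + (s + t) * ones w)
        ≡⟨ regroup c e s t (val b) n (ones w) ⟩
      c * suc n + e + (s + t) * (val b + ones w)
        ∎
      where
      regroup : ∀ c e s t B n O →
        c + t * B + (c * n + e + s * B + (s + t) * O) ≡ c * suc n + e + (s + t) * (B + O)
      regroup = solve-∀

module Corners = ColumnwiseCount isCorner (λ _ _ _ _ → refl) (λ _ _ _ → refl) (λ _ _ _ → refl)
module HorizontalSides = ColumnwiseCount isHSide (λ _ _ _ _ → refl) (λ _ _ _ → refl) (λ _ _ _ → refl)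
module VerticalSides = ColumnwiseCount isVSide (λ _ _ _ _ → refl) (λ _ _ _ → refl) (λ _ _ _ → refl)

ver-closed : ∀ {n} (w : Vec Bool (suc n)) → noConsecOnes w ≡ true → ver w ≡ 2 * suc n + 2 + 2 * ones w
ver-closed {n} w nc =
  trans (length-filterᵇ (Corners.adjacent (cells w)) (box (suc n)))
        (Corners.ClosedForm.count-cells 2 2 1 1
          (λ { false → refl ; true → refl })
          (λ { false → refl ; true → refl })
          (λ { false false _ → refl ; false true _ → refl ; true false _ → refl ; true true () })
          w nc)

edg-closed : ∀ {n} (w : Vec Bool (suc n)) → noConsecOnes w ≡ true → edg w ≡ 3 * suc n + 1 + 3 * ones w
edg-closed {n} w nc =
  trans (cong₂ _+_
          (trans (length-filterᵇ (HorizontalSides.adjacent (cells w)) (box (suc n)))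
                 (HorizontalSides.ClosedForm.count-cells 2 0 0 1
                   (λ { false → refl ; true → refl })
                   (λ { false → refl ; true → refl })
                   (λ { false false _ → refl ; false true _ → refl ; true false _ → refl ; true true () })
                   w nc))
          (trans (length-filterᵇ (VerticalSides.adjacent (cells w)) (box (suc n)))
                 (VerticalSides.ClosedForm.count-cells 1 1 1 1
                   (λ { false → refl ; true → refl })
                   (λ { false → refl ; true → refl })
                   (λ { false false _ → refl ; false true _ → refl ; true false _ → refl ; true true () })
                   w nc)))
        (regroup (suc n) (ones w))
  where
  regroup : ∀ N O → 2 * N + 0 + (0 + 1) * O + (1 * N + 1 + (1 + 1) * O) ≡ 3 * N + 1 + 3 * O
  regroup = solve-∀

weightF₂ : ∀ {n} → (ℕ → ℕ) → Vec Bool n → ℕ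
weightF₂ h w = if noConsecOnes w then h (ones w) else 0

ΣF₂ : ℕ → (ℕ → ℕ) → ℕ
ΣF₂ n h = sum (map (weightF₂ h) (allWords n))

sum-allWords-suc : ∀ {n} (φ : Vec Bool (suc n) → ℕ) →
  sum (map φ (allWords (suc n))) ≡ sum (map (λ w → φ (false ∷ w) + φ (true ∷ w)) (allWords n))
sum-allWords-suc {n} φ = go (allWords n)
  where
  go : ∀ ws → sum (map φ (concatMap (λ w → (false ∷ w) ∷ (true ∷ w) ∷ []) ws))
            ≡ sum (map (λ w → φ (false ∷ w) + φ (true ∷ w)) ws)
  go [] = refl
  go (w ∷ ws) = trans (cong (λ r → φ (false ∷ w) + (φ (true ∷ w) + r)) (go ws)) (sym (+-assoc (φ (false ∷ w)) _ _))

weightF₂-false : ∀ {n} h (w : Vec Bool n) → weightF₂ h (false ∷ w) ≡ weightF₂ h w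
weightF₂-false h [] = refl
weightF₂-false h (_ ∷ _) = refl

weightF₂-true-false : ∀ {n} h (w : Vec Bool n) → weightF₂ h (true ∷ false ∷ w) ≡ weightF₂ (h ∘ suc) w
weightF₂-true-false h [] = refl
weightF₂-true-false h (_ ∷ _) = refl

-- A word of 𝓕_{n+2,2} is 0 followed by a word of 𝓕_{n+1,2}, or 10 followed by a word of 𝓕_{n,2}.
ΣF₂-rec : ∀ n h → ΣF₂ (suc (suc n)) h ≡ ΣF₂ (suc n) h + ΣF₂ n (h ∘ suc)
ΣF₂-rec n h = begin
  ΣF₂ (suc (suc n)) h
    ≡⟨ sum-allWords-suc {suc n} (weightF₂ h) ⟩
  sum (map (λ w → weightF₂ h (false ∷ w) + weightF₂ h (true ∷ w)) (allWords (suc n)))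
    ≡⟨ sum-map-+ (weightF₂ h ∘ (false ∷_)) (weightF₂ h ∘ (true ∷_)) (allWords (suc n)) ⟩
  sum (map (weightF₂ h ∘ (false ∷_)) (allWords (suc n))) + sum (map (weightF₂ h ∘ (true ∷_)) (allWords (suc n)))
    ≡⟨ cong₂ _+_ (cong sum (map-cong (weightF₂-false h) (allWords (suc n)))) (sum-allWords-suc {n} (weightF₂ h ∘ (true ∷_))) ⟩
  ΣF₂ (suc n) h + sum (map (λ w → weightF₂ h (true ∷ false ∷ w) + weightF₂ h (true ∷ true ∷ w)) (allWords n))
    ≡⟨ cong (λ l → ΣF₂ (suc n) h + sum l) (map-cong (λ w → trans (+-identityʳ _) (weightF₂-true-false h w)) (allWords n)) ⟩
  ΣF₂ (suc n) h + ΣF₂ n (h ∘ suc)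
    ∎

ΣF₂-scale : ∀ n c {g h : ℕ → ℕ} → (∀ i → g i ≡ c * h i) → ΣF₂ n g ≡ c * ΣF₂ n h
ΣF₂-scale n c {g} {h} g≡ch =
  trans (cong sum (map-cong weight-scale (allWords n))) (sum-map-*ˡ c (weightF₂ h) (allWords n))
  where
  weight-scale : ∀ w → (if noConsecOnes w then g (ones w) else 0) ≡ c * (if noConsecOnes w then h (ones w) else 0)
  weight-scale w with noConsecOnes w
  ... | true  = g≡ch (ones w)
  ... | false = sym (*-zeroʳ c)

binomialTerm : ℕ → (ℕ → ℕ) → ℕ → ℕ
binomialTerm x h i = ((x ∸ i) C i) * h i

C-pascal : ∀ c j → (c ∸ j) C suc j + (c ∸ j) C j ≡ (suc c ∸ j) C suc j
C-pascal c j with j ≤? c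
... | yes j≤c rewrite +-∸-assoc 1 j≤c =
  trans (+-comm ((c ∸ j) C suc j) _) (nCk+nC[k+1]≡[n+1]C[k+1] (c ∸ j) j)
... | no j≰c rewrite m≤n⇒m∸n≡0 (<⇒≤ (≰⇒> j≰c)) | m≤n⇒m∸n≡0 (≰⇒> j≰c) =
  k>n⇒nCk≡0 (≤-<-trans z≤n (≰⇒> j≰c))

⌊n/2⌋<m⇒n<m+m : ∀ x {i} → ⌊ x /2⌋ < i → x < i + i
⌊n/2⌋<m⇒n<m+m zero {suc i} _ = z<s
⌊n/2⌋<m⇒n<m+m (suc zero) {suc i} _ = ≤-<-trans (s≤s z≤n) (m<m+n (suc i) z<s)
⌊n/2⌋<m⇒n<m+m (suc (suc x)) {suc i} (s≤s lt) =
  s≤s (subst (suc (suc x) ≤_) (sym (+-suc i i)) (s≤s (⌊n/2⌋<m⇒n<m+m x lt)))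

binomialTerm-vanish : ∀ x h {i} → ⌊ x /2⌋ < i → binomialTerm x h i ≡ 0
binomialTerm-vanish x h {suc i} lt =
  cong (_* h (suc i)) (k>n⇒nCk≡0 (m<n+o⇒m∸n<o x (suc i) (⌊n/2⌋<m⇒n<m+m x lt)))

binomial-truncate : ∀ x h {m} → ⌊ x /2⌋ < m →
  sum (applyUpTo (binomialTerm x h) m) ≡ sum (applyUpTo (binomialTerm x h) (suc ⌊ x /2⌋))
binomial-truncate x h lt = sum-applyUpTo-truncate (binomialTerm x h) lt (λ i → binomialTerm-vanish x h)

ΣF₂-binomial : ∀ n h {m} → ⌊ suc n /2⌋ < m → ΣF₂ n h ≡ sum (applyUpTo (binomialTerm (suc n) h) m)
ΣF₂-binomial zero h lt = trans (sym (+-identityʳ (h 0 + 0))) (sym (binomial-truncate 1 h lt))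
ΣF₂-binomial (suc zero) h lt =
  trans (cong₂ _+_ (sym (+-identityʳ (h 0))) (sym (+-identityʳ (h 1 + 0)))) (sym (binomial-truncate 2 h lt))
ΣF₂-binomial (suc (suc n)) h {suc m} (s≤s lt) = begin
  ΣF₂ (suc (suc n)) h
    ≡⟨ ΣF₂-rec n h ⟩
  ΣF₂ (suc n) h + ΣF₂ n (h ∘ suc)
    ≡⟨ cong₂ _+_ (ΣF₂-binomial (suc n) h (s≤s (≤-<-trans (⌊n/2⌋-mono (n≤1+n n)) lt)))
                 (ΣF₂-binomial n (h ∘ suc) lt) ⟩
  h 0 + 0 + sum (applyUpTo (binomialTerm (suc (suc n)) h ∘ suc) m) + sum (applyUpTo (binomialTerm (suc n) (h ∘ suc)) m)
    ≡⟨ +-assoc (h 0 + 0) _ _ ⟩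
  h 0 + 0 + (sum (applyUpTo (binomialTerm (suc (suc n)) h ∘ suc) m) + sum (applyUpTo (binomialTerm (suc n) (h ∘ suc)) m))
    ≡⟨ cong (h 0 + 0 +_) (sum-applyUpTo-+ pascal-term m) ⟩
  sum (applyUpTo (binomialTerm (suc (suc (suc n))) h) (suc m))
    ∎
  where
  pascal-term : ∀ i → binomialTerm (suc (suc n)) h (suc i) + binomialTerm (suc n) (h ∘ suc) i
                    ≡ binomialTerm (suc (suc (suc n))) h (suc i)
  pascal-term i = trans (sym (*-distribʳ-+ (h (suc i)) ((suc n ∸ i) C suc i) _))
                        (cong (_* h (suc i)) (C-pascal (suc n) i))

monomial : ℕ → ℕ → ℕ → ℕ → ℕ
monomial p q n i = p ^ (3 * n + 1 + 3 * i) * q ^ (2 * n + 2 + 2 * i)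

^-*-split : ∀ p q a b c d → p ^ (a + b) * q ^ (c + d) ≡ p ^ a * q ^ c * (p ^ b * q ^ d)
^-*-split p q a b c d =
  trans (cong₂ _*_ (^-distribˡ-+-* p a b) (^-distribˡ-+-* q c d)) (*-interchange (p ^ a) _ _ _)

monomial-suc : ∀ p q n i → monomial p q (suc n) i ≡ p ^ 3 * q ^ 2 * monomial p q n i
monomial-suc p q n i =
  trans (cong₂ (λ a b → p ^ a * q ^ b) (exponent 3 1 n i) (exponent 2 2 n i))
        (^-*-split p q 3 (3 * n + 1 + 3 * i) 2 (2 * n + 2 + 2 * i))
  where
  exponent : ∀ k c n i → k * suc n + c + k * i ≡ k + (k * n + c + k * i)
  exponent = solve-∀

monomial-suc-suc : ∀ p q n i → monomial p q (suc (suc n)) (suc i) ≡ p ^ 9 * q ^ 6 * monomial p q n i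
monomial-suc-suc p q n i =
  trans (cong₂ (λ a b → p ^ a * q ^ b) (exponent 3 1 n i) (exponent 2 2 n i))
        (^-*-split p q 9 (3 * n + 1 + 3 * i) 6 (2 * n + 2 + 2 * i))
  where
  exponent : ∀ k c n i → k * suc (suc n) + c + k * suc i ≡ 3 * k + (k * n + c + k * i)
  exponent = solve-∀

v-ΣF₂ : ∀ n p q → v (suc n) p q ≡ ΣF₂ (suc n) (monomial p q (suc n))
v-ΣF₂ n p q =
  trans (sum-filterᵇ noConsecOnes (λ w → p ^ edg w * q ^ ver w) (allWords (suc n)))
        (cong sum (map-cong term (allWords (suc n))))
  where
  term : ∀ w → (if noConsecOnes w then p ^ edg w * q ^ ver w else 0)
             ≡ (if noConsecOnes w then monomial p q (suc n) (ones w) else 0)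
  term w with noConsecOnes w in nc
  ... | true  = cong₂ (λ a b → p ^ a * q ^ b) (edg-closed w nc) (ver-closed w nc)
  ... | false = refl

v-recurrence : ∀ n p q →
  v (suc (suc (suc n))) p q ≡ p ^ 3 * q ^ 2 * v (suc (suc n)) p q + p ^ 9 * q ^ 6 * v (suc n) p q
v-recurrence n p q = begin
  v (suc (suc (suc n))) p q
    ≡⟨ v-ΣF₂ (suc (suc n)) p q ⟩
  ΣF₂ (suc (suc (suc n))) (monomial p q (suc (suc (suc n))))
    ≡⟨ ΣF₂-rec (suc n) (monomial p q (suc (suc (suc n)))) ⟩
  ΣF₂ (suc (suc n)) (monomial p q (suc (suc (suc n)))) + ΣF₂ (suc n) (monomial p q (suc (suc (suc n))) ∘ suc)
    ≡⟨ cong₂ _+_ (ΣF₂-scale (suc (suc n)) (p ^ 3 * q ^ 2) (monomial-suc p q (suc (suc n))))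
                 (ΣF₂-scale (suc n) (p ^ 9 * q ^ 6) (monomial-suc-suc p q (suc n))) ⟩
  p ^ 3 * q ^ 2 * ΣF₂ (suc (suc n)) (monomial p q (suc (suc n))) + p ^ 9 * q ^ 6 * ΣF₂ (suc n) (monomial p q (suc n))
    ≡⟨ cong₂ (λ a b → p ^ 3 * q ^ 2 * a + p ^ 9 * q ^ 6 * b) (v-ΣF₂ (suc n) p q) (v-ΣF₂ n p q) ⟨
  p ^ 3 * q ^ 2 * v (suc (suc n)) p q + p ^ 9 * q ^ 6 * v (suc n) p q
    ∎

v-binomial : ∀ n p q →
  v (suc n) p q ≡ sum (map (λ i → ((suc n + 1 ∸ i) C i) * monomial p q (suc n) i) (upTo (⌊ suc n + 1 /2⌋ + 1)))
v-binomial n p q rewrite +-comm n 1 =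
  trans (v-ΣF₂ n p q)
        (trans (ΣF₂-binomial (suc n) (monomial p q (suc n)) (m<m+n ⌊ suc (suc n) /2⌋ z<s))
               (cong sum (sym (map-upTo (binomialTerm (suc (suc n)) (monomial p q (suc n))) (⌊ suc (suc n) /2⌋ + 1)))))

theorem2p3 :
  (∀ (n : ℕ) → 3 ≤ n → ∀ (p q : ℕ) →
      v n p q ≡ p ^ 3 * q ^ 2 * v (n ∸ 1) p q + p ^ 9 * q ^ 6 * v (n ∸ 2) p q)
  × (∀ (p q : ℕ) → v 1 p q ≡ p ^ 4 * q ^ 4 + p ^ 7 * q ^ 6)
  × (∀ (p q : ℕ) → v 2 p q ≡ p ^ 7 * q ^ 6 + 2 * (p ^ 10 * q ^ 8))
  × (∀ (n : ℕ) → 1 ≤ n → ∀ (p q : ℕ) →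
      v n p q ≡ sum (map (λ i → ((n + 1 ∸ i) C i) * (p ^ (3 * n + 1 + 3 * i) * q ^ (2 * n + 2 + 2 * i)))
                         (upTo (⌊ n + 1 /2⌋ + 1))))
theorem2p3 =
  (λ { (suc (suc (suc n))) _ → v-recurrence n ; (suc zero) (s≤s ()) ; (suc (suc zero)) (s≤s (s≤s ())) })
  , (λ p q → cong (p ^ 4 * q ^ 4 +_) (+-identityʳ _))
  , (λ p q → refl)
  , (λ { (suc n) _ → v-binomial n })
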